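{- Let $k,m\geq 1$ and $0\le x<2k$ be integers, $n=2km+x$, with $(x,n)\notin\{(1,4),(1,6)\}$. Then $$\lambda^k(\overrightarrow{C_n})=\left\lfloor \frac{n}{2}\right\rfloor+\left\lfloor \frac{\lceil n/2\rceil}{k}\right\rfloor.$$
   Context: $\overrightarrow{C_n}$ is the directed cycle (circuit) on $n$ vertices and $\overleftrightarrow{K_n}$ the complete digraph on $n$ vertices (all arcs $(u,v)$, $u\ne v$). A $p$-labeled packing of $k$ copies of $\overrightarrow{C_n}$ is a map $f$ from $V(\overleftrightarrow{K_n})$ onto a set of exactly $p$ labels together with injections $\sigma_1,\dots,\sigma_k:V(\overrightarrow{C_n})\to V(\overleftrightarrow{K_n})$ such that for $i\neq j$ the induced arc images $\sigma_i^*(E(\overrightarrow{C_n}))$ and $\sigma_j^*(E(\overrightarrow{C_n}))$ are disjoint, and for every vertex $v$, $f(\sigma_1(v))=\dots=f(\sigma_k(v))$. $\lambda^k(\overrightarrow{C_n})$ is the largest $p$ for which such a packing exists. -}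

module Defs where

open import Data.Nat using (ℕ; zero; suc; _+_; _*_; _≤_; NonZero)
open import Data.Nat.DivMod using (_mod_)
open import Data.Fin using (Fin; toℕ)
open import Data.Product using (Σ; _×_; _,_)
open import Relation.Binary.PropositionalEquality using (_≡_; _≢_)
open import Relation.Nullary using (¬_)
open import Function.Definitions using (Injective; Surjective)

-- Vertices of the directed cycle C_n and of the complete digraph K_n are Fin n.
-- Successor on the cycle: i ↦ (i + 1) mod n.
cnext : ∀ {n} → Fin n → Fin n
cnext {suc n} i = suc (toℕ i) mod (suc n)

arcImage : ∀ {n} → (Fin n → Fin n) → Fin n → Fin n × Fin n
arcImage σ u = σ u , σ (cnext u)

record LabeledPacking (n k p : ℕ) : Set where
  field
    f       : Fin n → Fin p
    f-onto  : Surjective _≡_ _≡_ f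
    σ       : Fin k → Fin n → Fin n
    σ-inj   : ∀ i → Injective _≡_ _≡_ (σ i)
    disjoint : ∀ i j → i ≢ j → ∀ u v → arcImage (σ i) u ≢ arcImage (σ j) v
    labels  : ∀ i j v → f (σ i v) ≡ f (σ j v)

IsLambda : ℕ → ℕ → ℕ → Set
IsLambda n k L = LabeledPacking n k L × (∀ p → LabeledPacking n k p → p ≤ L)

module Submission where

-- All copies induce the same labelling v ↦ f (σᵢ v) of the cycle. A vertex whose class is a singleton
-- is fixed by every copy, so the k copies of an arc leaving it end at k distinct vertices of one
-- class. Hence every class is a singleton, has at least 2 vertices, or is fed by singletons and has
-- at least k vertices and at least as many as it receives arcs from singletons; maximising the number
-- of classes under these constraints gives at most ⌊n/2⌋ + ⌊⌈n/2⌉/k⌋ labels.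
-- For the matching packing, every odd vertex is a fixed singleton, and the ⌈n/2⌉ even vertices are cut
-- into ⌊⌈n/2⌉/k⌋ intervals of at least k consecutive ones, each forming a class that copy i rotates by i.
-- Every arc of the cycle has an even endpoint, where distinct copies differ.

open import Defs
open import Data.Bool using (if_then_else_)
open import Data.Fin using (Fin; zero; suc; toℕ; fromℕ<; punchOut)
open import Data.Fin.Properties
  using (toℕ-fromℕ<; toℕ-injective; toℕ<n; punchOut-injective; injective⇒≤; any?)
  renaming (_≟_ to _≟ᶠ_; suc-injective to suc-injectiveᶠ; 0≢1+n to 0≢1+nᶠ)
open import Data.Nat using (ℕ; zero; suc; _+_; _*_; _∸_; _≤_; _<_; _/_; _%_; ⌊_/2⌋; ⌈_/2⌉; NonZero; z≤n; s≤s; _⊓_; _<?_; _≤?_; parity)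
open import Data.Parity.Base using (Parity; 0ℙ; 1ℙ; _⁻¹)
open import Data.Nat.Properties
open import Data.Nat.DivMod
open import Data.Nat.Tactic.RingSolver using (solve; solve-∀)
open import Data.List using (_∷_; [])
open import Data.Product using (_×_; _,_; proj₁; proj₂; ∃)
open import Data.Sum using (_⊎_; inj₁; inj₂)
open import Function using (_∘_)
open import Function.Definitions using (Injective; Surjective)
open import Relation.Binary.PropositionalEquality
open import Relation.Nullary using (¬_; Dec; yes; no; does; contradiction)
open import Algebra.Properties.Semiring.Sum +-*-semiring
  using (sum; sum-syntax; sum-cong-≗; sum-replicate-zero; ∑-comm; ∑-distrib-+; *-distribˡ-sum; *-distribʳ-sum)

𝟙 : {A : Set} → Dec A → ℕ
𝟙 d = if does d then 1 else 0

𝟙-yes : {A : Set} (d : Dec A) → A → 𝟙 d ≡ 1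
𝟙-yes (yes _) _ = refl
𝟙-yes (no ¬a) a = contradiction a ¬a

𝟙-no : {A : Set} (d : Dec A) → ¬ A → 𝟙 d ≡ 0
𝟙-no (yes a) ¬a = contradiction a ¬a
𝟙-no (no _) _ = refl

sum-mono-≤ : ∀ {n} {f g : Fin n → ℕ} → (∀ i → f i ≤ g i) → sum f ≤ sum g
sum-mono-≤ {zero} _ = z≤n
sum-mono-≤ {suc n} f≤g = +-mono-≤ (f≤g zero) (sum-mono-≤ (f≤g ∘ suc))

sum-ones : ∀ n → ∑[ i < n ] 1 ≡ n
sum-ones zero = refl
sum-ones (suc n) = cong suc (sum-ones n)

sum-positive : ∀ {n} (f : Fin n → ℕ) → 1 ≤ sum f → ∃ λ i → 1 ≤ f i
sum-positive {suc n} f 1≤Σ with f zero in eq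
... | suc _ = zero , subst (1 ≤_) (sym eq) (s≤s z≤n)
... | zero with i , 1≤fi ← sum-positive (f ∘ suc) 1≤Σ = suc i , 1≤fi

∑-δ : ∀ {n} (a : Fin n) (β : Fin n → ℕ) → ∑[ w < n ] (𝟙 (a ≟ᶠ w) * β w) ≡ β a
∑-δ {suc n} zero β = trans (cong₂ _+_ (+-identityʳ (β zero)) (sum-replicate-zero n)) (+-identityʳ _)
∑-δ {suc n} (suc a) β = ∑-δ a (β ∘ suc)

fibreWeight : ∀ {n p} → (Fin n → Fin p) → (Fin n → ℕ) → Fin p → ℕ
fibreWeight {n} h w ℓ = ∑[ v < n ] (𝟙 (h v ≟ᶠ ℓ) * w v)

fibreSize : ∀ {n p} → (Fin n → Fin p) → Fin p → ℕ
fibreSize h = fibreWeight h (λ _ → 1)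

sum-fibreWeight : ∀ {n p} (h : Fin n → Fin p) (w : Fin n → ℕ) →
  ∑[ ℓ < p ] fibreWeight h w ℓ ≡ sum w
sum-fibreWeight {n} {p} h w = trans (∑-comm {p} {n} _) (sum-cong-≗ λ v → ∑-δ (h v) (λ _ → w v))

fibreWeight-∘ : ∀ {n p} (h : Fin n → Fin p) (β : Fin p → ℕ) ℓ →
  fibreWeight h (β ∘ h) ℓ ≡ fibreSize h ℓ * β ℓ
fibreWeight-∘ {n} h β ℓ = trans (sum-cong-≗ pointwise) (sym (*-distribʳ-sum {n} (β ℓ) _))
  where
  pointwise : ∀ v → 𝟙 (h v ≟ᶠ ℓ) * β (h v) ≡ 𝟙 (h v ≟ᶠ ℓ) * 1 * β ℓ
  pointwise v with h v ≟ᶠ ℓ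
  ... | yes refl = refl
  ... | no _ = refl

fibreWeight-empty : ∀ {n p} (h : Fin n → Fin p) (w : Fin n → ℕ) ℓ →
  (∀ v → h v ≢ ℓ) → fibreWeight h w ℓ ≡ 0
fibreWeight-empty {n} h w ℓ ∉ =
  trans (sum-cong-≗ λ v → cong (_* w v) (𝟙-no (h v ≟ᶠ ℓ) (∉ v))) (sum-replicate-zero n)

fibreSize-injective : ∀ {m n} {ι : Fin m → Fin n} → Injective _≡_ _≡_ ι → ∀ w → fibreSize ι w ≤ 1
fibreSize-injective {zero} _ w = z≤n
fibreSize-injective {suc m} {ι = ι} inj w with ι zero ≟ᶠ w
... | no _ = fibreSize-injective (suc-injectiveᶠ ∘ inj) w
... | yes ι₀≡w = ≤-reflexive (cong suc
  (fibreWeight-empty (ι ∘ suc) _ w λ v ιv≡w → 0≢1+nᶠ (inj (trans ι₀≡w (sym ιv≡w)))))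

sum-≤-injective : ∀ {m n} {ι : Fin m → Fin n} → Injective _≡_ _≡_ ι →
  (α : Fin m → ℕ) (β : Fin n → ℕ) → (∀ i → α i ≤ β (ι i)) → sum α ≤ sum β
sum-≤-injective {m} {n} {ι} inj α β α≤βι = begin
  sum α                                ≤⟨ sum-mono-≤ α≤βι ⟩
  ∑[ i < m ] β (ι i)                   ≡⟨ sum-fibreWeight ι (β ∘ ι) ⟨
  ∑[ w < n ] fibreWeight ι (β ∘ ι) w   ≡⟨ sum-cong-≗ (fibreWeight-∘ ι β) ⟩
  ∑[ w < n ] (fibreSize ι w * β w)     ≤⟨ sum-mono-≤ (λ w → *-monoˡ-≤ (β w) (fibreSize-injective inj w)) ⟩
  ∑[ w < n ] (1 * β w)                 ≡⟨ sum-cong-≗ (λ w → *-identityˡ (β w)) ⟩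
  sum β                                ∎
  where open ≤-Reasoning

injection⇒≤fibreSize : ∀ {m n p} {h : Fin n → Fin p} {ι : Fin m → Fin n} {ℓ} →
  Injective _≡_ _≡_ ι → (∀ i → h (ι i) ≡ ℓ) → m ≤ fibreSize h ℓ
injection⇒≤fibreSize {m} {h = h} {ι} {ℓ} inj hι≡ℓ = begin
  m                  ≡⟨ sum-ones m ⟨
  ∑[ i < m ] 1       ≤⟨ sum-≤-injective inj _ _ (λ i → ≤-reflexive (sym (trans (*-identityʳ _) (𝟙-yes (h (ι i) ≟ᶠ ℓ) (hι≡ℓ i))))) ⟩
  fibreSize h ℓ      ∎
  where open ≤-Reasoning

2*m≤n⇒m≤⌊n/2⌋ : ∀ {m n} → 2 * m ≤ n → m ≤ ⌊ n /2⌋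
2*m≤n⇒m≤⌊n/2⌋ {m} {n} 2m≤n =
  subst (_≤ ⌊ n /2⌋) (sym (n≡⌊n+n/2⌋ m)) (⌊n/2⌋-mono (subst (_≤ n) (cong (m +_) (+-identityʳ m)) 2m≤n))

m<[1+m/n]*n : ∀ m n .{{_ : NonZero n}} → m < suc (m / n) * n
m<[1+m/n]*n m n = begin-strict
  m                  ≡⟨ m≡m%n+[m/n]*n m n ⟩
  m % n + m / n * n  <⟨ +-monoˡ-< (m / n * n) (m%n<n m n) ⟩
  suc (m / n) * n    ∎
  where open ≤-Reasoning

class-count-bound : ∀ j {s a b X Y n} → s + X + Y ≤ n → (2 + j) * a ≤ X → s ≤ X → 2 * b ≤ Y →
  s + a + b ≤ ⌊ n /2⌋ + ⌈ n /2⌉ / (2 + j)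
class-count-bound j {s} {a} {b} {X} {Y} {n} total ka≤X s≤X 2b≤Y = bound (a ≤? q)
  where
  open ≤-Reasoning
  r = ⌊ n /2⌋
  q = ⌈ n /2⌉ / (2 + j)

  s+b≤r : s + b ≤ r
  s+b≤r = 2*m≤n⇒m≤⌊n/2⌋ (begin
    2 * (s + b)        ≡⟨ solve (s ∷ b ∷ []) ⟩
    s + (s + 2 * b)    ≤⟨ +-monoʳ-≤ s (+-mono-≤ s≤X 2b≤Y) ⟩
    s + (X + Y)        ≡⟨ +-assoc s X Y ⟨
    s + X + Y          ≤⟨ total ⟩
    n                  ∎)

  s≤r : s ≤ r
  s≤r = ≤-trans (m≤m+n s b) s+b≤r

  regroup : ∀ r q j → r + (r + suc q * (2 + j)) ≡ 2 * suc (r + q) + j * suc q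
  regroup = solve-∀

  bound : Dec (a ≤ q) → s + a + b ≤ r + q
  bound (yes a≤q) = begin
    s + a + b          ≡⟨ solve (s ∷ a ∷ b ∷ []) ⟩
    s + b + a          ≤⟨ +-mono-≤ s+b≤r a≤q ⟩
    r + q              ∎
  -- Now k a > ⌈n/2⌉: the k vertices of each fed class outweigh the one label it contributes.
  bound (no a≰q) = ≤-pred (*-cancelˡ-< 2 _ _ (+-cancelʳ-< (j * suc q) _ _ (begin-strict
    2 * (s + a + b) + j * suc q        ≤⟨ +-monoʳ-≤ (2 * (s + a + b)) (*-monoʳ-≤ j (≰⇒> a≰q)) ⟩
    2 * (s + a + b) + j * a            ≡⟨ solve (s ∷ a ∷ b ∷ j ∷ []) ⟩
    s + (s + (2 + j) * a + 2 * b)      ≤⟨ +-mono-≤ s≤r (≤-trans (+-mono-≤ (+-monoʳ-≤ s ka≤X) 2b≤Y) total) ⟩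
    r + n                              ≡⟨ cong (r +_) (⌊n/2⌋+⌈n/2⌉≡n n) ⟨
    r + (r + ⌈ n /2⌉)                  <⟨ +-monoʳ-< r (+-monoʳ-< r (m<[1+m/n]*n ⌈ n /2⌉ (2 + j))) ⟩
    r + (r + suc q * (2 + j))          ≡⟨ regroup r q j ⟩
    2 * suc (r + q) + j * suc q        ∎)))

[m+i]%n-cancel : ∀ m i n .{{_ : NonZero n}} → i ≤ n → ((m + i) % n + (n ∸ i)) % n ≡ m % n
[m+i]%n-cancel m i n i≤n = begin
  ((m + i) % n + (n ∸ i)) % n          ≡⟨ %-distribˡ-+ ((m + i) % n) (n ∸ i) n ⟩
  ((m + i) % n % n + (n ∸ i) % n) % n  ≡⟨ cong (λ z → (z + (n ∸ i) % n) % n) (m%n%n≡m%n (m + i) n) ⟩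
  ((m + i) % n + (n ∸ i) % n) % n      ≡⟨ %-distribˡ-+ (m + i) (n ∸ i) n ⟨
  (m + i + (n ∸ i)) % n                ≡⟨ cong (_% n) (trans (+-assoc m i (n ∸ i)) (cong (m +_) (m+[n∸m]≡n i≤n))) ⟩
  (m + n) % n                          ≡⟨ [m+n]%n≡m%n m n ⟩
  m % n                                ∎
  where open ≡-Reasoning

[m+i]%n-injective : ∀ {m m′} i n .{{_ : NonZero n}} → m < n → m′ < n → i ≤ n →
  (m + i) % n ≡ (m′ + i) % n → m ≡ m′
[m+i]%n-injective {m} {m′} i n m<n m′<n i≤n eq = begin
  m                            ≡⟨ m<n⇒m%n≡m m<n ⟨
  m % n                        ≡⟨ [m+i]%n-cancel m i n i≤n ⟨
  ((m + i) % n + (n ∸ i)) % n  ≡⟨ cong (λ z → (z + (n ∸ i)) % n) eq ⟩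
  ((m′ + i) % n + (n ∸ i)) % n ≡⟨ [m+i]%n-cancel m′ i n i≤n ⟩
  m′ % n                       ≡⟨ m<n⇒m%n≡m m′<n ⟩
  m′                           ∎
  where open ≡-Reasoning

toℕ-cnext : ∀ {n} (i : Fin (suc n)) → toℕ (cnext i) ≡ suc (toℕ i) % suc n
toℕ-cnext i = toℕ-fromℕ< _

cnext-injective : ∀ {n} → Injective _≡_ _≡_ (cnext {n})
cnext-injective {suc n} {i} {i′} eq = toℕ-injective ([m+i]%n-injective 1 (suc n) (toℕ<n i) (toℕ<n i′) (s≤s z≤n)
  (begin
    (toℕ i + 1) % suc n   ≡⟨ cong (_% suc n) (+-comm (toℕ i) 1) ⟩
    suc (toℕ i) % suc n   ≡⟨ toℕ-cnext i ⟨
    toℕ (cnext i)         ≡⟨ cong toℕ eq ⟩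
    toℕ (cnext i′)        ≡⟨ toℕ-cnext i′ ⟩
    suc (toℕ i′) % suc n  ≡⟨ cong (_% suc n) (+-comm 1 (toℕ i′)) ⟩
    (toℕ i′ + 1) % suc n  ∎))
  where open ≡-Reasoning

injective⇒surjective : ∀ {n} {σ : Fin n → Fin n} → Injective _≡_ _≡_ σ → ∀ w → ∃ λ v → σ v ≡ w
injective⇒surjective {suc n} {σ} inj w with any? (λ v → σ v ≟ᶠ w)
... | yes hit = hit
... | no miss = contradiction (injective⇒≤ τ-injective) 1+n≰n
  where
  τ : Fin (suc n) → Fin n
  τ v = punchOut {i = w} {j = σ v} (λ w≡σv → miss (v , sym w≡σv))
  τ-injective : Injective _≡_ _≡_ τ
  τ-injective {x} {y} eq =
    inj (punchOut-injective {i = w} (λ e → miss (x , sym e)) (λ e → miss (y , sym e)) eq)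

surjective⇒≤ : ∀ {n p} {f : Fin n → Fin p} → Surjective _≡_ _≡_ f → p ≤ n
surjective⇒≤ {f = f} onto = injective⇒≤ {f = section} λ {ℓ} {ℓ′} eq →
  trans (sym (proj₂ (onto ℓ) refl)) (trans (cong f eq) (proj₂ (onto ℓ′) refl))
  where
  section = λ ℓ → proj₁ (onto ℓ)

-- A label class with c vertices, into which d arcs of the cycle lead from singleton classes, is a
-- singleton (isOne c), fed (isPos d; it then has at least k and at least d vertices) or loose (isLoose d c).
isOne : ℕ → ℕ
isOne 1 = 1
isOne _ = 0

isOne≤1 : ∀ c → isOne c ≤ 1
isOne≤1 0 = z≤n
isOne≤1 1 = ≤-refl
isOne≤1 (suc (suc _)) = z≤n

isOne-pos : ∀ {c} → 1 ≤ isOne c → c ≡ 1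
isOne-pos {1} _ = refl

m*isOne[m]≡isOne[m] : ∀ c → c * isOne c ≡ isOne c
m*isOne[m]≡isOne[m] 0 = refl
m*isOne[m]≡isOne[m] 1 = refl
m*isOne[m]≡isOne[m] (suc (suc c)) = *-zeroʳ (suc (suc c))

isPos : ℕ → ℕ
isPos zero = 0
isPos (suc _) = 1

isLoose : ℕ → ℕ → ℕ
isLoose zero 1 = 0
isLoose zero _ = 1
isLoose (suc _) _ = 0

record ClassBounds (k c d : ℕ) : Set where
  field
    classified : 1 ≤ isOne c + isPos d + isLoose d c
    exclusive  : isOne c + isPos d * c + isLoose d c * c ≤ c
    fed≥k      : k * isPos d ≤ isPos d * c
    fed≥d      : d ≤ isPos d * c
    loose≥2    : 2 * isLoose d c ≤ isLoose d c * c

classBounds : ∀ {k c d} → 2 ≤ k → 1 ≤ c → (1 ≤ d → k ≤ c) → d ≤ c → ClassBounds k c d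
classBounds {k} {1} {zero} _ _ _ _ = record
  { classified = ≤-refl ; exclusive = ≤-refl ; fed≥k = ≤-reflexive (*-zeroʳ k) ; fed≥d = z≤n ; loose≥2 = z≤n }
classBounds {k} {1} {suc d} 2≤k _ fed⇒k≤c _ = contradiction (≤-trans 2≤k (fed⇒k≤c (s≤s z≤n))) 1+n≰n
classBounds {k} {c@(suc (suc _))} {zero} _ _ _ _ = record
  { classified = ≤-refl ; exclusive = ≤-reflexive (+-identityʳ c) ; fed≥k = ≤-reflexive (*-zeroʳ k)
  ; fed≥d = z≤n ; loose≥2 = s≤s (s≤s z≤n) }
classBounds {k} {c@(suc (suc _))} {d@(suc _)} _ _ fed⇒k≤c d≤c = record
  { classified = ≤-refl ; exclusive = ≤-reflexive (trans (+-identityʳ _) (+-identityʳ c))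
  ; fed≥k = subst₂ _≤_ (sym (*-identityʳ k)) (sym (+-identityʳ c)) (fed⇒k≤c (s≤s z≤n))
  ; fed≥d = subst (d ≤_) (sym (+-identityʳ c)) d≤c ; loose≥2 = z≤n }

module LabelCount {n j p} (P : LabeledPacking n (2 + j) p) where
  open LabeledPacking P

  private
    σ₀ : Fin n → Fin n
    σ₀ = σ zero

    preimage : Fin n → Fin n
    preimage w = proj₁ (injective⇒surjective (σ-inj zero) w)

    σ₀-preimage : ∀ w → σ₀ (preimage w) ≡ w
    σ₀-preimage w = proj₂ (injective⇒surjective (σ-inj zero) w)

  label : Fin n → Fin p
  label v = f (σ₀ v)

  label-σ : ∀ i v → f (σ i v) ≡ label v
  label-σ i v = labels i zero v

  label-preimage : ∀ w → label (preimage w) ≡ f w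
  label-preimage w = cong f (σ₀-preimage w)

  classSize : Fin p → ℕ
  classSize = fibreSize label

  isSingleton : Fin n → ℕ
  isSingleton v = isOne (classSize (label v))

  singletons : ℕ
  singletons = sum isSingleton

  fed : Fin p → ℕ
  fed = fibreWeight (label ∘ cnext) isSingleton

  classSize-pos : ∀ ℓ → 1 ≤ classSize ℓ
  classSize-pos ℓ with w , fw≡ℓ ← f-onto ℓ =
    injection⇒≤fibreSize {h = label} {ι = λ _ → preimage w} (λ { {zero} {zero} _ → refl })
      (λ _ → trans (label-preimage w) (fw≡ℓ refl))

  singleton-unique : ∀ {ℓ u v} → classSize ℓ ≡ 1 → label u ≡ ℓ → label v ≡ ℓ → u ≡ v
  singleton-unique {ℓ} {u} {v} size≡1 lu≡ℓ lv≡ℓ with u ≟ᶠ v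
  ... | yes u≡v = u≡v
  ... | no u≢v = contradiction (subst (2 ≤_) size≡1 (injection⇒≤fibreSize {h = label} pair-injective pair-label)) 1+n≰n
    where
    pair : Fin 2 → Fin n
    pair zero = u
    pair (suc zero) = v
    pair-injective : Injective _≡_ _≡_ pair
    pair-injective {zero} {zero} _ = refl
    pair-injective {zero} {suc zero} u≡v = contradiction u≡v u≢v
    pair-injective {suc zero} {zero} v≡u = contradiction (sym v≡u) u≢v
    pair-injective {suc zero} {suc zero} _ = refl
    pair-label : ∀ i → label (pair i) ≡ ℓ
    pair-label zero = lu≡ℓ
    pair-label (suc zero) = lv≡ℓ

  singleton-fixed : ∀ {v} → classSize (label v) ≡ 1 → ∀ i → σ i v ≡ σ₀ v
  singleton-fixed {v} size≡1 i = trans (sym (σ₀-preimage (σ i v)))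
    (cong σ₀ (singleton-unique size≡1 (trans (label-preimage (σ i v)) (label-σ i v)) refl))

  fed-source : ∀ ℓ → 1 ≤ fed ℓ → ∃ λ v → classSize (label v) ≡ 1 × label (cnext v) ≡ ℓ
  fed-source ℓ 1≤fed with sum-positive _ 1≤fed
  ... | v , 1≤term with label (cnext v) ≟ᶠ ℓ
  ...   | yes next≡ℓ = v , isOne-pos (subst (1 ≤_) (+-identityʳ _) 1≤term) , next≡ℓ
  ...   | no _ = contradiction 1≤term λ ()

  fed-large : ∀ ℓ → 1 ≤ fed ℓ → 2 + j ≤ classSize ℓ
  fed-large ℓ 1≤fed with v , size≡1 , next≡ℓ ← fed-source ℓ 1≤fed =
    injection⇒≤fibreSize {h = label} {ι = ι} ι-injective ι-label
    where
    ι : Fin (2 + j) → Fin n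
    ι i = preimage (σ i (cnext v))
    ι-label : ∀ i → label (ι i) ≡ ℓ
    ι-label i = trans (label-preimage _) (trans (label-σ i (cnext v)) next≡ℓ)
    ι-injective : Injective _≡_ _≡_ ι
    ι-injective {i} {i′} eq with i ≟ᶠ i′
    ... | yes i≡i′ = i≡i′
    ... | no i≢i′ = contradiction (cong₂ _,_ (trans (singleton-fixed size≡1 i) (sym (singleton-fixed size≡1 i′)))
                      (trans (sym (σ₀-preimage _)) (trans (cong σ₀ eq) (σ₀-preimage _))))
                    (disjoint i i′ i≢i′ v v)

  fed≤classSize : ∀ ℓ → fed ℓ ≤ classSize ℓ
  fed≤classSize ℓ = sum-≤-injective cnext-injective _ _ λ v →
    *-monoʳ-≤ (𝟙 (label (cnext v) ≟ᶠ ℓ)) (isOne≤1 (classSize (label v)))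

  sum-classSize : ∑[ ℓ < p ] classSize ℓ ≡ n
  sum-classSize = trans (sum-fibreWeight label _) (sum-ones n)

  sum-fed : ∑[ ℓ < p ] fed ℓ ≡ singletons
  sum-fed = sum-fibreWeight (label ∘ cnext) isSingleton

  sum-isOne : ∑[ ℓ < p ] isOne (classSize ℓ) ≡ singletons
  sum-isOne = begin
    ∑[ ℓ < p ] isOne (classSize ℓ)                             ≡⟨ sum-cong-≗ (m*isOne[m]≡isOne[m] ∘ classSize) ⟨
    ∑[ ℓ < p ] (classSize ℓ * isOne (classSize ℓ))             ≡⟨ sum-cong-≗ (fibreWeight-∘ label (isOne ∘ classSize)) ⟨
    ∑[ ℓ < p ] fibreWeight label (isOne ∘ classSize ∘ label) ℓ ≡⟨ sum-fibreWeight label isSingleton ⟩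
    singletons                                                 ∎
    where open ≡-Reasoning

  labelClassBounds : ∀ ℓ → ClassBounds (2 + j) (classSize ℓ) (fed ℓ)
  labelClassBounds ℓ = classBounds (s≤s (s≤s z≤n)) (classSize-pos ℓ) (fed-large ℓ) (fed≤classSize ℓ)

  fedClasses looseClasses fedVertices looseVertices : ℕ
  fedClasses = ∑[ ℓ < p ] isPos (fed ℓ)
  looseClasses = ∑[ ℓ < p ] isLoose (fed ℓ) (classSize ℓ)
  fedVertices = ∑[ ℓ < p ] (isPos (fed ℓ) * classSize ℓ)
  looseVertices = ∑[ ℓ < p ] (isLoose (fed ℓ) (classSize ℓ) * classSize ℓ)

  open ≤-Reasoning

  p≤classes : p ≤ singletons + fedClasses + looseClasses
  p≤classes = begin
    p                                                          ≡⟨ sum-ones p ⟨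
    ∑[ ℓ < p ] 1                                               ≤⟨ sum-mono-≤ (ClassBounds.classified ∘ labelClassBounds) ⟩
    ∑[ ℓ < p ] (isOne (classSize ℓ) + isPos (fed ℓ) + isLoose (fed ℓ) (classSize ℓ))
                                                               ≡⟨ ∑-distrib-+ {p} _ _ ⟩
    ∑[ ℓ < p ] (isOne (classSize ℓ) + isPos (fed ℓ)) + looseClasses
                                                               ≡⟨ cong (_+ looseClasses) (∑-distrib-+ {p} _ _) ⟩
    ∑[ ℓ < p ] isOne (classSize ℓ) + fedClasses + looseClasses ≡⟨ cong (λ z → z + fedClasses + looseClasses) sum-isOne ⟩
    singletons + fedClasses + looseClasses                     ∎

  vertices≤n : singletons + fedVertices + looseVertices ≤ n
  vertices≤n = begin
    singletons + fedVertices + looseVertices                   ≡⟨ cong (λ z → z + fedVertices + looseVertices) sum-isOne ⟨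
    ∑[ ℓ < p ] isOne (classSize ℓ) + fedVertices + looseVertices
                                                               ≡⟨ cong (_+ looseVertices) (∑-distrib-+ {p} _ _) ⟨
    ∑[ ℓ < p ] (isOne (classSize ℓ) + isPos (fed ℓ) * classSize ℓ) + looseVertices
                                                               ≡⟨ ∑-distrib-+ {p} _ _ ⟨
    ∑[ ℓ < p ] (isOne (classSize ℓ) + isPos (fed ℓ) * classSize ℓ + isLoose (fed ℓ) (classSize ℓ) * classSize ℓ)
                                                               ≤⟨ sum-mono-≤ (ClassBounds.exclusive ∘ labelClassBounds) ⟩
    ∑[ ℓ < p ] classSize ℓ                                     ≡⟨ sum-classSize ⟩
    n                                                          ∎

  k*fedClasses≤fedVertices : (2 + j) * fedClasses ≤ fedVertices
  k*fedClasses≤fedVertices = begin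
    (2 + j) * fedClasses                                       ≡⟨ *-distribˡ-sum {p} (2 + j) _ ⟩
    ∑[ ℓ < p ] ((2 + j) * isPos (fed ℓ))                       ≤⟨ sum-mono-≤ (ClassBounds.fed≥k ∘ labelClassBounds) ⟩
    fedVertices                                                ∎

  singletons≤fedVertices : singletons ≤ fedVertices
  singletons≤fedVertices = begin
    singletons                                                 ≡⟨ sum-fed ⟨
    ∑[ ℓ < p ] fed ℓ                                           ≤⟨ sum-mono-≤ (ClassBounds.fed≥d ∘ labelClassBounds) ⟩
    fedVertices                                                ∎

  2*looseClasses≤looseVertices : 2 * looseClasses ≤ looseVertices
  2*looseClasses≤looseVertices = begin
    2 * looseClasses                                           ≡⟨ *-distribˡ-sum {p} 2 _ ⟩
    ∑[ ℓ < p ] (2 * isLoose (fed ℓ) (classSize ℓ))             ≤⟨ sum-mono-≤ (ClassBounds.loose≥2 ∘ labelClassBounds) ⟩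
    looseVertices                                              ∎

  labelCount-bound : p ≤ ⌊ n /2⌋ + ⌈ n /2⌉ / (2 + j)
  labelCount-bound = ≤-trans p≤classes (class-count-bound j vertices≤n
    k*fedClasses≤fedVertices singletons≤fedVertices 2*looseClasses≤looseVertices)

packing-upper-bound : ∀ {n k p} .{{_ : NonZero k}} → LabeledPacking n k p → p ≤ ⌊ n /2⌋ + ⌈ n /2⌉ / k
packing-upper-bound {n} {1} {p} P = begin
  p                      ≤⟨ surjective⇒≤ (LabeledPacking.f-onto P) ⟩
  n                      ≡⟨ ⌊n/2⌋+⌈n/2⌉≡n n ⟨
  ⌊ n /2⌋ + ⌈ n /2⌉      ≡⟨ cong (⌊ n /2⌋ +_) (n/1≡n ⌈ n /2⌉) ⟨
  ⌊ n /2⌋ + ⌈ n /2⌉ / 1  ∎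
  where open ≤-Reasoning
packing-upper-bound {k = suc (suc j)} P = LabelCount.labelCount-bound P

double : ℕ → ℕ
double zero = zero
double (suc j) = suc (suc (double j))

parity-suc : ∀ x → parity (suc x) ≡ parity x ⁻¹
parity-suc zero = refl
parity-suc (suc zero) = refl
parity-suc (suc (suc x)) = parity-suc x

parity-double : ∀ j → parity (double j) ≡ 0ℙ
parity-double zero = refl
parity-double (suc j) = parity-double j

parity-suc-double : ∀ j → parity (suc (double j)) ≡ 1ℙ
parity-suc-double zero = refl
parity-suc-double (suc j) = parity-suc-double j

⌊double/2⌋ : ∀ j → ⌊ double j /2⌋ ≡ j
⌊double/2⌋ zero = refl
⌊double/2⌋ (suc j) = cong suc (⌊double/2⌋ j)

⌊suc-double/2⌋ : ∀ j → ⌊ suc (double j) /2⌋ ≡ j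
⌊suc-double/2⌋ zero = refl
⌊suc-double/2⌋ (suc j) = cong suc (⌊suc-double/2⌋ j)

double-injective : ∀ {j j′} → double j ≡ double j′ → j ≡ j′
double-injective {j} {j′} eq = trans (sym (⌊double/2⌋ j)) (trans (cong ⌊_/2⌋ eq) (⌊double/2⌋ j′))

even⇒double : ∀ x → parity x ≡ 0ℙ → x ≡ double ⌊ x /2⌋
even⇒double zero _ = refl
even⇒double (suc (suc x)) e = cong (λ y → suc (suc y)) (even⇒double x e)

odd⇒suc-double : ∀ x → parity x ≡ 1ℙ → x ≡ suc (double ⌊ x /2⌋)
odd⇒suc-double (suc zero) _ = refl
odd⇒suc-double (suc (suc x)) e = cong (λ y → suc (suc y)) (odd⇒suc-double x e)

double<⇒<⌈/2⌉ : ∀ {j n} → double j < n → j < ⌈ n /2⌉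
double<⇒<⌈/2⌉ {zero} {suc n} _ = s≤s z≤n
double<⇒<⌈/2⌉ {suc j} {suc (suc n)} (s≤s (s≤s lt)) = s≤s (double<⇒<⌈/2⌉ lt)

<⌈/2⌉⇒double< : ∀ {j n} → j < ⌈ n /2⌉ → double j < n
<⌈/2⌉⇒double< {zero} {suc n} _ = s≤s z≤n
<⌈/2⌉⇒double< {suc j} {suc (suc n)} (s≤s lt) = s≤s (s≤s (<⌈/2⌉⇒double< lt))

suc-double<⇒<⌊/2⌋ : ∀ {j n} → suc (double j) < n → j < ⌊ n /2⌋
suc-double<⇒<⌊/2⌋ {zero} {suc zero} (s≤s ())
suc-double<⇒<⌊/2⌋ {zero} {suc (suc n)} _ = s≤s z≤n
suc-double<⇒<⌊/2⌋ {suc j} {suc (suc n)} (s≤s (s≤s lt)) = s≤s (suc-double<⇒<⌊/2⌋ lt)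

<⌊/2⌋⇒suc-double< : ∀ {j n} → j < ⌊ n /2⌋ → suc (double j) < n
<⌊/2⌋⇒suc-double< {zero} {suc (suc n)} _ = s≤s (s≤s z≤n)
<⌊/2⌋⇒suc-double< {suc j} {suc (suc n)} (s≤s lt) = s≤s (s≤s (<⌊/2⌋⇒suc-double< lt))

cnext-cases : ∀ {n} (u : Fin n) →
  (suc (toℕ u) < n × toℕ (cnext u) ≡ suc (toℕ u)) ⊎ (suc (toℕ u) ≡ n × toℕ (cnext u) ≡ 0)
cnext-cases {suc n} u with m≤n⇒m<n∨m≡n (toℕ<n u)
... | inj₁ lt = inj₁ (lt , trans (toℕ-cnext u) (m<n⇒m%n≡m lt))
... | inj₂ eq = inj₂ (eq , trans (toℕ-cnext u) (trans (cong (_% suc n) eq) (n%n≡0 (suc n))))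

cnext-odd : ∀ {n} (u : Fin n) → parity (toℕ u) ≡ 1ℙ → parity (toℕ (cnext u)) ≡ 0ℙ
cnext-odd u odd with cnext-cases u
... | inj₁ (_ , next≡) = trans (cong parity next≡) (trans (parity-suc (toℕ u)) (cong _⁻¹ odd))
... | inj₂ (_ , next≡) = cong parity next≡

cnext-even-even : ∀ {n} (u : Fin n) → parity (toℕ u) ≡ 0ℙ → parity (toℕ (cnext u)) ≡ 0ℙ → suc (toℕ u) ≡ n
cnext-even-even u even even′ with cnext-cases u
... | inj₁ (_ , next≡) = contradiction
  (trans (sym (cong _⁻¹ even)) (trans (sym (parity-suc (toℕ u))) (trans (cong parity (sym next≡)) even′))) λ ()
... | inj₂ (last , _) = last

m*n≤o⇒m≤o/n : ∀ {m o} n .{{_ : NonZero n}} → m * n ≤ o → m ≤ o / n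
m*n≤o⇒m≤o/n {m} n mn≤o = subst (_≤ _ / n) (m*n/n≡m m n) (/-monoˡ-≤ n mn≤o)

m*n≤o<[1+m]*n⇒o/n≡m : ∀ {m o} n .{{_ : NonZero n}} → m * n ≤ o → o < suc m * n → o / n ≡ m
m*n≤o<[1+m]*n⇒o/n≡m n mn≤o o<[1+m]n = ≤-antisym (≤-pred (m<n*o⇒m/o<n o<[1+m]n)) (m*n≤o⇒m≤o/n n mn≤o)

rotateWithin : ∀ s L .{{_ : NonZero L}} → ℕ → ℕ → ℕ
rotateWithin s L i j = s + (j ∸ s + i) % L

module _ {s L : ℕ} .{{_ : NonZero L}} where

  rotateWithin-lower : ∀ i j → s ≤ rotateWithin s L i j
  rotateWithin-lower i j = m≤m+n s _

  rotateWithin-upper : ∀ i j → rotateWithin s L i j < s + L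
  rotateWithin-upper i j = +-monoʳ-< s (m%n<n (j ∸ s + i) L)

  rotateWithin-injective : ∀ {i j j′} → i ≤ L → s ≤ j → s ≤ j′ → j < s + L → j′ < s + L →
    rotateWithin s L i j ≡ rotateWithin s L i j′ → j ≡ j′
  rotateWithin-injective {i} {j} {j′} i≤L s≤j s≤j′ j<s+L j′<s+L eq = begin
    j             ≡⟨ m+[n∸m]≡n s≤j ⟨
    s + (j ∸ s)   ≡⟨ cong (s +_) (([m+i]%n-injective i L (m<n+o⇒m∸n<o j s j<s+L) (m<n+o⇒m∸n<o j′ s j′<s+L) i≤L
                       (+-cancelˡ-≡ s _ _ eq))) ⟩
    s + (j′ ∸ s)  ≡⟨ m+[n∸m]≡n s≤j′ ⟩
    j′            ∎
    where open ≡-Reasoning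

  rotateWithin-injectiveˡ : ∀ {i i′ j} → i < L → i′ < L → j < s + L →
    rotateWithin s L i j ≡ rotateWithin s L i′ j → i ≡ i′
  rotateWithin-injectiveˡ {i} {i′} {j} i<L i′<L j<s+L eq =
    [m+i]%n-injective (j ∸ s) L i<L i′<L (<⇒≤ (m<n+o⇒m∸n<o j s j<s+L))
      (trans (cong (_% L) (+-comm i (j ∸ s))) (trans (+-cancelˡ-≡ s _ _ eq) (cong (_% L) (+-comm (j ∸ s) i′))))

module BlockRotation (k′ h : ℕ) (k≤h : suc k′ ≤ h) where

  k q q′ : ℕ
  k = suc k′
  q = h / k
  q′ = q ∸ 1

  q≡1+q′ : q ≡ suc q′
  q≡1+q′ = sym (m+[n∸m]≡n (m≥n⇒m/n>0 k≤h))

  block : ℕ → ℕ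
  block j = j / k ⊓ q′

  block≤q′ : ∀ j → block j ≤ q′
  block≤q′ j = m⊓n≤n (j / k) q′

  extra : ℕ → ℕ
  extra c with c <? q′
  ... | yes _ = 0
  ... | no _ = h % k

  start length end : ℕ → ℕ
  start c = c * k
  length c = k + extra c
  end c = start c + length c

  inner-end : ∀ {c} → c < q′ → end c ≡ suc c * k
  inner-end {c} c<q′ with c <? q′
  ... | yes _ = trans (cong (c * k +_) (+-identityʳ k)) (+-comm (c * k) k)
  ... | no c≮q′ = contradiction c<q′ c≮q′

  last-end : end q′ ≡ h
  last-end with q′ <? q′
  ... | yes q′<q′ = contradiction q′<q′ (<-irrefl refl)
  ... | no _ = begin
    q′ * k + (k + h % k)    ≡⟨ +-assoc (q′ * k) k (h % k) ⟨
    q′ * k + k + h % k      ≡⟨ cong (_+ h % k) (trans (+-comm (q′ * k) k) (cong (_* k) (sym q≡1+q′))) ⟩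
    q * k + h % k           ≡⟨ +-comm (q * k) (h % k) ⟩
    h % k + q * k           ≡⟨ m≡m%n+[m/n]*n h k ⟨
    h                       ∎
    where open ≡-Reasoning

  record InBlock (c j : ℕ) : Set where
    field
      start≤j     : start c ≤ j
      j<end       : j < end c
      end≤h       : end c ≤ h
      block-const : ∀ {t} → start c ≤ t → t < end c → block t ≡ c

  inBlock : ∀ {j} → j < h → InBlock (block j) j
  inBlock {j} j<h with j / k <? q′
  ... | yes inner = subst (λ c → InBlock c j) (sym (m≤n⇒m⊓n≡m (<⇒≤ inner))) record
    { start≤j = m/n*n≤m j k
    ; j<end = subst (j <_) (sym (inner-end inner)) (m<[1+m/n]*n j k)
    ; end≤h = begin
        end (j / k)           ≡⟨ inner-end inner ⟩
        suc (j / k) * k       ≤⟨ *-monoˡ-≤ k inner ⟩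
        q′ * k                ≤⟨ m≤m+n (q′ * k) (length q′) ⟩
        end q′                ≡⟨ last-end ⟩
        h                     ∎
    ; block-const = λ {t} ck≤t t<end → trans
        (cong (_⊓ q′) (m*n≤o<[1+m]*n⇒o/n≡m k ck≤t (subst (t <_) (inner-end inner) t<end)))
        (m≤n⇒m⊓n≡m (<⇒≤ inner)) }
    where open ≤-Reasoning
  ... | no last = subst (λ c → InBlock c j) (sym (m≥n⇒m⊓n≡n (≮⇒≥ last))) record
    { start≤j = ≤-trans (*-monoˡ-≤ k (≮⇒≥ last)) (m/n*n≤m j k)
    ; j<end = subst (j <_) (sym last-end) j<h
    ; end≤h = ≤-reflexive last-end
    ; block-const = λ q′k≤t _ → m≥n⇒m⊓n≡n (m*n≤o⇒m≤o/n k q′k≤t) }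

  inBlock-≡ : ∀ {c j} → block j ≡ c → j < h → InBlock c j
  inBlock-≡ refl = inBlock

  rotateIn : ℕ → ℕ → ℕ → ℕ
  rotateIn c = rotateWithin (start c) (length c)

  rotate : ℕ → ℕ → ℕ
  rotate i j = rotateIn (block j) i j

  module _ {c j : ℕ} (j∈c : InBlock c j) (i : ℕ) where
    open InBlock j∈c

    rotateIn-block : block (rotateIn c i j) ≡ c
    rotateIn-block = block-const (rotateWithin-lower i j) (rotateWithin-upper i j)

    rotateIn<h : rotateIn c i j < h
    rotateIn<h = <-≤-trans (rotateWithin-upper i j) end≤h

  block-rotate : ∀ {j} → j < h → ∀ i → block (rotate i j) ≡ block j
  block-rotate j<h = rotateIn-block (inBlock j<h)

  rotate<h : ∀ {j} → j < h → ∀ i → rotate i j < h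
  rotate<h j<h = rotateIn<h (inBlock j<h)

  rotate-injective : ∀ {i j j′} → i < k → j < h → j′ < h → rotate i j ≡ rotate i j′ → j ≡ j′
  rotate-injective {i} {j} {j′} i<k j<h j′<h eq =
    rotateWithin-injective (≤-trans (<⇒≤ i<k) (m≤m+n k _)) (start≤j j∈c) (start≤j j′∈c) (j<end j∈c) (j<end j′∈c)
      (trans eq (cong (λ c → rotateIn c i j′) same-block))
    where
    open InBlock
    same-block : block j′ ≡ block j
    same-block = trans (sym (block-rotate j′<h i)) (trans (cong block (sym eq)) (block-rotate j<h i))
    j∈c = inBlock j<h
    j′∈c = inBlock-≡ same-block j′<h

  rotate-injectiveˡ : ∀ {i i′ j} → i < k → i′ < k → j < h → rotate i j ≡ rotate i′ j → i ≡ i′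
  rotate-injectiveˡ i<k i′<k j<h =
    rotateWithin-injectiveˡ (<-≤-trans i<k (m≤m+n k _)) (<-≤-trans i′<k (m≤m+n k _)) (InBlock.j<end (inBlock j<h))

  block-start : ∀ {c} → c ≤ q′ → block (c * k) ≡ c
  block-start {c} c≤q′ = trans (cong (_⊓ q′) (m*n/n≡m c k)) (m≤n⇒m⊓n≡m c≤q′)

  start<h : ∀ {c} → c ≤ q′ → c * k < h
  start<h {c} c≤q′ = begin-strict
    c * k            ≤⟨ *-monoˡ-≤ k c≤q′ ⟩
    q′ * k           <⟨ m<m+n (q′ * k) (s≤s z≤n) ⟩
    end q′           ≡⟨ last-end ⟩
    h                ∎
    where open ≤-Reasoning

onParity : {A : Set} → Parity → A → A → A
onParity 0ℙ even odd = even
onParity 1ℙ even odd = odd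

parity-cases : ∀ x → parity x ≡ 0ℙ ⊎ parity x ≡ 1ℙ
parity-cases x with parity x
... | 0ℙ = inj₁ refl
... | 1ℙ = inj₂ refl

module Construction (n k′ : ℕ) (k≤⌈n/2⌉ : suc k′ ≤ ⌈ n /2⌉) where
  open BlockRotation k′ ⌈ n /2⌉ k≤⌈n/2⌉

  r : ℕ
  r = ⌊ n /2⌋

  shift : ℕ → ℕ → ℕ
  shift i x = onParity (parity x) (double (rotate i ⌊ x /2⌋)) x

  colour : ℕ → ℕ
  colour x = onParity (parity x) (r + block ⌊ x /2⌋) ⌊ x /2⌋

  shift-even : ∀ i x → parity x ≡ 0ℙ → shift i x ≡ double (rotate i ⌊ x /2⌋)
  shift-even i x e rewrite e = refl

  shift-odd : ∀ i x → parity x ≡ 1ℙ → shift i x ≡ x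
  shift-odd i x o rewrite o = refl

  colour-even : ∀ x → parity x ≡ 0ℙ → colour x ≡ r + block ⌊ x /2⌋
  colour-even x e rewrite e = refl

  colour-odd : ∀ x → parity x ≡ 1ℙ → colour x ≡ ⌊ x /2⌋
  colour-odd x o rewrite o = refl

  half<⌈n/2⌉ : ∀ x → x < n → parity x ≡ 0ℙ → ⌊ x /2⌋ < ⌈ n /2⌉
  half<⌈n/2⌉ x x<n e = double<⇒<⌈/2⌉ (subst (_< n) (even⇒double x e) x<n)

  parity-shift : ∀ i x → parity (shift i x) ≡ parity x
  parity-shift i x with parity-cases x
  ... | inj₁ e = trans (cong parity (shift-even i x e)) (trans (parity-double (rotate i ⌊ x /2⌋)) (sym e))
  ... | inj₂ o = cong parity (shift-odd i x o)

  shift<n : ∀ i {x} → x < n → shift i x < n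
  shift<n i {x} x<n with parity-cases x
  ... | inj₁ e = subst (_< n) (sym (shift-even i x e)) (<⌈/2⌉⇒double< (rotate<h (half<⌈n/2⌉ x x<n e) i))
  ... | inj₂ o = subst (_< n) (sym (shift-odd i x o)) x<n

  colour<r+q : ∀ {x} → x < n → colour x < r + q
  colour<r+q {x} x<n with parity-cases x
  ... | inj₁ e = subst (_< r + q) (sym (colour-even x e))
                   (+-monoʳ-< r (subst (block ⌊ x /2⌋ <_) (sym q≡1+q′) (s≤s (block≤q′ ⌊ x /2⌋))))
  ... | inj₂ o = subst (_< r + q) (sym (colour-odd x o))
                   (≤-trans (suc-double<⇒<⌊/2⌋ (subst (_< n) (odd⇒suc-double x o) x<n)) (m≤m+n r q))

  colour-shift : ∀ i {x} → x < n → colour (shift i x) ≡ colour x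
  colour-shift i {x} x<n with parity-cases x
  ... | inj₂ o = cong colour (shift-odd i x o)
  ... | inj₁ e = begin
    colour (shift i x)                       ≡⟨ cong colour (shift-even i x e) ⟩
    colour (double (rotate i ⌊ x /2⌋))       ≡⟨ colour-even (double (rotate i ⌊ x /2⌋)) (parity-double (rotate i ⌊ x /2⌋)) ⟩
    r + block ⌊ double (rotate i ⌊ x /2⌋) /2⌋ ≡⟨ cong (λ y → r + block y) (⌊double/2⌋ (rotate i ⌊ x /2⌋)) ⟩
    r + block (rotate i ⌊ x /2⌋)             ≡⟨ cong (r +_) (block-rotate (half<⌈n/2⌉ x x<n e) i) ⟩
    r + block ⌊ x /2⌋                        ≡⟨ colour-even x e ⟨
    colour x                                 ∎
    where open ≡-Reasoning

  shift-agree-parity : ∀ i i′ x y → shift i x ≡ shift i′ y → parity x ≡ parity y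
  shift-agree-parity i i′ x y eq = trans (sym (parity-shift i x)) (trans (cong parity eq) (parity-shift i′ y))

  shift-agree-odd : ∀ i i′ x y → parity x ≡ 1ℙ → shift i x ≡ shift i′ y → x ≡ y
  shift-agree-odd i i′ x y o eq =
    trans (sym (shift-odd i x o)) (trans eq (shift-odd i′ y (trans (sym (shift-agree-parity i i′ x y eq)) o)))

  shift-injective : ∀ {i x y} → i < k → x < n → y < n → shift i x ≡ shift i y → x ≡ y
  shift-injective {i} {x} {y} i<k x<n y<n eq with parity-cases x
  ... | inj₂ o = shift-agree-odd i i x y o eq
  ... | inj₁ e = begin
    x                  ≡⟨ even⇒double x e ⟩
    double ⌊ x /2⌋     ≡⟨ cong double (rotate-injective {i} {⌊ x /2⌋} {⌊ y /2⌋} i<k (half<⌈n/2⌉ x x<n e) (half<⌈n/2⌉ y y<n e′)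
                            (double-injective (trans (sym (shift-even i x e)) (trans eq (shift-even i y e′))))) ⟩
    double ⌊ y /2⌋     ≡⟨ even⇒double y e′ ⟨
    y                  ∎
    where
    open ≡-Reasoning
    e′ : parity y ≡ 0ℙ
    e′ = trans (sym (shift-agree-parity i i x y eq)) e

  shift-injectiveˡ : ∀ {i i′ x} → i < k → i′ < k → x < n → parity x ≡ 0ℙ → shift i x ≡ shift i′ x → i ≡ i′
  shift-injectiveˡ {i} {i′} {x} i<k i′<k x<n e eq = rotate-injectiveˡ {i} {i′} {⌊ x /2⌋} i<k i′<k (half<⌈n/2⌉ x x<n e)
    (double-injective (trans (sym (shift-even i x e)) (trans eq (shift-even i′ x e))))

  arc-agree⇒same-source : ∀ {i i′} (u v : Fin n) → shift i (toℕ u) ≡ shift i′ (toℕ v) →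
    shift i (toℕ (cnext u)) ≡ shift i′ (toℕ (cnext v)) → u ≡ v
  arc-agree⇒same-source {i = i} {i′} u v source-eq target-eq with parity-cases (toℕ u) | parity-cases (toℕ (cnext u))
  ... | inj₂ odd | _ = toℕ-injective (shift-agree-odd i i′ _ _ odd source-eq)
  ... | inj₁ _ | inj₂ odd = cnext-injective (toℕ-injective (shift-agree-odd i i′ _ _ odd target-eq))
  ... | inj₁ even | inj₁ even′ = toℕ-injective (suc-injective
    (trans (cnext-even-even u even even′) (sym (cnext-even-even v (transfer (toℕ u) (toℕ v) source-eq even)
      (transfer (toℕ (cnext u)) (toℕ (cnext v)) target-eq even′)))))
    where
    transfer : ∀ x y → shift i x ≡ shift i′ y → parity x ≡ 0ℙ → parity y ≡ 0ℙ
    transfer x y eq e = trans (sym (shift-agree-parity i i′ x y eq)) e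

  arc-agree⇒same-copy : ∀ {i i′} (u v : Fin n) → i < k → i′ < k → shift i (toℕ u) ≡ shift i′ (toℕ v) →
    shift i (toℕ (cnext u)) ≡ shift i′ (toℕ (cnext v)) → i ≡ i′
  arc-agree⇒same-copy u v i<k i′<k source-eq target-eq
    with refl ← arc-agree⇒same-source u v source-eq target-eq | parity-cases (toℕ u)
  ... | inj₁ even = shift-injectiveˡ i<k i′<k (toℕ<n u) even source-eq
  ... | inj₂ odd = shift-injectiveˡ i<k i′<k (toℕ<n (cnext u)) (cnext-odd u odd) target-eq

  colour-onto : ∀ {y} → y < r + q → ∃ λ x → x < n × colour x ≡ y
  colour-onto {y} y<r+q with y <? r
  ... | yes y<r = suc (double y) , <⌊/2⌋⇒suc-double< y<r ,
    trans (colour-odd (suc (double y)) (parity-suc-double y)) (⌊suc-double/2⌋ y)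
  ... | no y≮r = double (c * k) , <⌈/2⌉⇒double< (start<h c≤q′) , (begin
      colour (double (c * k))           ≡⟨ colour-even (double (c * k)) (parity-double (c * k)) ⟩
      r + block ⌊ double (c * k) /2⌋    ≡⟨ cong (λ z → r + block z) (⌊double/2⌋ (c * k)) ⟩
      r + block (c * k)                 ≡⟨ cong (r +_) (block-start c≤q′) ⟩
      r + c                             ≡⟨ m+[n∸m]≡n (≮⇒≥ y≮r) ⟩
      y                                 ∎)
    where
    open ≡-Reasoning
    c = y ∸ r
    c≤q′ : c ≤ q′
    c≤q′ = ≤-pred (subst (c <_) q≡1+q′ (+-cancelˡ-< r c q (subst (_< r + q) (sym (m+[n∸m]≡n (≮⇒≥ y≮r))) y<r+q)))

  embed : Fin k → Fin n → Fin n
  embed i v = fromℕ< (shift<n (toℕ i) (toℕ<n v))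

  labelling : Fin n → Fin (r + q)
  labelling v = fromℕ< (colour<r+q (toℕ<n v))

  toℕ-embed : ∀ i v → toℕ (embed i v) ≡ shift (toℕ i) (toℕ v)
  toℕ-embed i v = toℕ-fromℕ< _

  toℕ-labelling : ∀ v → toℕ (labelling v) ≡ colour (toℕ v)
  toℕ-labelling v = toℕ-fromℕ< _

  embed-agree : ∀ {i i′ u v} → embed i u ≡ embed i′ v → shift (toℕ i) (toℕ u) ≡ shift (toℕ i′) (toℕ v)
  embed-agree {i} {i′} {u} {v} eq = trans (sym (toℕ-embed i u)) (trans (cong toℕ eq) (toℕ-embed i′ v))

  embed-injective : ∀ i → Injective _≡_ _≡_ (embed i)
  embed-injective i {u} {v} eq = toℕ-injective (shift-injective (toℕ<n i) (toℕ<n u) (toℕ<n v) (embed-agree {i} {i} {u} {v} eq))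

  embed-disjoint : ∀ i i′ → i ≢ i′ → ∀ u v → arcImage (embed i) u ≢ arcImage (embed i′) v
  embed-disjoint i i′ i≢i′ u v eq = i≢i′ (toℕ-injective
    (arc-agree⇒same-copy u v (toℕ<n i) (toℕ<n i′) (embed-agree {i} {i′} {u} {v} (cong proj₁ eq))
      (embed-agree {i} {i′} {cnext u} {cnext v} (cong proj₂ eq))))

  labelling-embed : ∀ i v → labelling (embed i v) ≡ labelling v
  labelling-embed i v = toℕ-injective (begin
    toℕ (labelling (embed i v))  ≡⟨ toℕ-labelling (embed i v) ⟩
    colour (toℕ (embed i v))     ≡⟨ cong colour (toℕ-embed i v) ⟩
    colour (shift (toℕ i) (toℕ v)) ≡⟨ colour-shift (toℕ i) (toℕ<n v) ⟩
    colour (toℕ v)               ≡⟨ toℕ-labelling v ⟨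
    toℕ (labelling v)            ∎)
    where open ≡-Reasoning

  labelling-onto : Surjective _≡_ _≡_ labelling
  labelling-onto ℓ with x , x<n , colour-x≡ℓ ← colour-onto (toℕ<n ℓ) = fromℕ< x<n , λ { refl →
    toℕ-injective (trans (toℕ-labelling (fromℕ< x<n)) (trans (cong colour (toℕ-fromℕ< x<n)) colour-x≡ℓ)) }

  packing : LabeledPacking n k (r + q)
  packing = record
    { f = labelling
    ; f-onto = labelling-onto
    ; σ = embed
    ; σ-inj = embed-injective
    ; disjoint = embed-disjoint
    ; labels = λ i i′ v → trans (labelling-embed i v) (sym (labelling-embed i′ v))
    }

lambda-value : ∀ n k′ → 2 * suc k′ ≤ n → IsLambda n (suc k′) (⌊ n /2⌋ + ⌈ n /2⌉ / suc k′)
lambda-value n k′ 2k≤n = Construction.packing n k′ k≤⌈n/2⌉ , λ p → packing-upper-bound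
  where
  k≤⌈n/2⌉ : suc k′ ≤ ⌈ n /2⌉
  k≤⌈n/2⌉ = ≤-trans (2*m≤n⇒m≤⌊n/2⌋ 2k≤n) (⌊n/2⌋≤⌈n/2⌉ n)

mainTheorem8 : (k m x n : ℕ) → .{{_ : NonZero k}} → 1 ≤ m → x < 2 * k →
    n ≡ 2 * k * m + x → ¬ (x ≡ 1 × n ≡ 4) → ¬ (x ≡ 1 × n ≡ 6) →
    IsLambda n k (⌊ n /2⌋ + ⌈ n /2⌉ / k)
mainTheorem8 k@(suc k′) m x n 1≤m _ n≡2km+x _ _ = lambda-value n k′ (begin
  2 * k          ≡⟨ *-identityʳ (2 * k) ⟨
  2 * k * 1      ≤⟨ *-monoʳ-≤ (2 * k) 1≤m ⟩
  2 * k * m      ≤⟨ m≤m+n (2 * k * m) x ⟩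
  2 * k * m + x  ≡⟨ n≡2km+x ⟨
  n              ∎)
  where open ≤-Reasoning
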